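{- Let $A=\{a_s(n_s)\}_{s=1}^k$ be an exact covering system which is not the trivial ECS $\{0(1)\}$. Suppose that $A$ has a maximal modulus of the form $p_1^{k_1}p_2^{k_2}$, where $p_1,p_2$ are primes and $k_1,k_2\geq 0$ are integers. Then $A$ primely splits some exact covering system $B$.
   Context: For integers $a$ and $n\geq 1$, $a(n)$ denotes the arithmetic progression $a+n\mathbb{Z}$, and $n$ is its modulus. An exact covering system (ECS) is a finite list $\{a_s(n_s)\}_{s=1}^k$ of arithmetic progressions (repetitions of moduli allowed) which partitions $\mathbb{Z}$, i.e. every integer lies in exactly one of them. The trivial ECS is $\{0(1)\}$. A modulus $n_r$ of an ECS is maximal if it is maximal with respect to divisibility among the moduli, i.e. it does not properly divide any other modulus of the ECS. An ECS $A$ primely splits an ECS $B$ (written $A\models B$) if there is a prime $p$ such that, after reordering, $B=\{a_i(n_i)\}_{i=1}^k$ and $A=\{a_i(n_i)\}_{i=1}^{k-1}\cup\{a_k+jn_k\,(pn_k)\}_{j=0}^{p-1}$; that is, $A$ is obtained from $B$ by splitting one progression $a_k(n_k)$ into the $p$ progressions $a_k+jn_k+pn_k\mathbb{Z}$, $0\le j\le p-1$. -}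

module Defs where

open import Data.Nat as ℕ using (ℕ; _≤_)
open import Data.Nat.Primality using (Prime)
open import Data.Integer as ℤ using (ℤ; +_)
open import Data.Integer.Divisibility using (_∣_)
import Data.Nat.Divisibility as ℕD
open import Data.Product using (_×_; _,_; Σ; ∃; ∃-syntax; proj₂)
open import Data.List using (List; []; _∷_; _++_; _∷ʳ_; map; upTo; length; lookup)
open import Data.List.Relation.Unary.All using (All)
open import Data.List.Relation.Binary.Pointwise using (Pointwise)
open import Data.List.Relation.Binary.Permutation.Propositional using (_↭_)
open import Data.Fin using (Fin)
open import Relation.Binary.PropositionalEquality using (_≡_)
open import Relation.Nullary using (¬_)

-- An arithmetic progression a(n) = a + nℤ, represented by the pair (a , n).
AP : Set
AP = ℤ × ℕ

residue : AP → ℤ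
residue (a , _) = a

modulus : AP → ℕ
modulus (_ , n) = n

_∈AP_ : ℤ → AP → Set
x ∈AP (a , n) = (+ n) ∣ (x ℤ.- a)

_≈AP_ : AP → AP → Set
(a , n) ≈AP (b , m) = (n ≡ m) × ((+ n) ∣ (a ℤ.- b))

-- An exact covering system: a finite list of progressions with moduli ≥ 1
-- such that every integer lies in exactly one of them (counted by index).
IsECS : List AP → Set
IsECS A =
  All (λ P → 1 ≤ modulus P) A ×
  ((x : ℤ) → ∃[ i ] ((x ∈AP lookup A i) × ((j : Fin (length A)) → x ∈AP lookup A j → j ≡ i)))

IsTrivial : List AP → Set
IsTrivial A = Pointwise _≈AP_ A ((+ 0 , 1) ∷ [])

splitAP : ℕ → AP → List AP
splitAP p (a , n) = map (λ j → (a ℤ.+ (+ j) ℤ.* (+ n) , p ℕ.* n)) (upTo p)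

-- A primely splits B: for some prime p, after reordering B = C ++ [a(n)] and
-- A = C ++ {a + j n (p n)}_{j<p}, progressions compared as sets.
PrimelySplits : List AP → List AP → Set
PrimelySplits A B =
  ∃[ p ] (Prime p × ∃[ C ] ∃[ P ] ((B ↭ (C ∷ʳ P)) ×
    ∃[ A' ] ((A ↭ A') × Pointwise _≈AP_ A' (C ++ splitAP p P))))

IsMaximalModulus : List AP → ℕ → Set
IsMaximalModulus A m =
  ∃[ r ] ((modulus (lookup A r) ≡ m) ×
    ((s : Fin (length A)) → m ℕD.∣ modulus (lookup A s) → m ≡ modulus (lookup A s)))

module Submission where

-- Exactness is handled by counting, for each integer y, the members of a list
-- containing y; this count is invariant under permutation and additive over
-- concatenation.  Fix x, the residue of a member of modulus m.  The switching
-- lemma says: if every modulus of A divides T, divides S or equals m, and x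
-- lies in a member of modulus m, then so does x + T or x + S.  For a prime p
-- with m = p h and p^e ∣ h, Bézout gives a direction τ ≡ h (mod m) divisible by
-- every modulus not divisible by p^(e+1).  The splitting construction shows:
-- if every x + j h (j < p) lies in a member of modulus m, these p members are
-- exactly the members of modulus m inside x(h), and replacing them by x(h)
-- gives an exact covering system B that A primely splits.  The theorem then
-- treats the shapes m = 1 (A is trivial), m = p^(e+1) (switch with T = S = j τ)
-- and m = p^(e+1) q^(f+1) (switch between i τ_p and j τ_q).

open import Defs
open import Data.Nat as ℕ using (ℕ; zero; suc; _*_; _^_; _≤_; _<_; z≤n; s≤s)
import Data.Nat.Properties as ℕP
import Data.Nat.Divisibility as ℕD
open import Data.Nat.Primality using (Prime; prime⇒nonZero; prime⇒nonTrivial; prime⇒irreducible; euclidsLemma)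
open import Data.Nat.Coprimality using (Coprime; coprime-Bézout; coprime-divisor)
open import Data.Nat.GCD using (module Bézout)
open import Data.Nat.Induction using (<-wellFounded)
open import Induction.WellFounded using (Acc; acc)
open import Data.Integer as ℤ using (ℤ; +_; _+_; _-_; -_)
import Data.Integer.Properties as ℤP
open import Data.Integer.Divisibility.Signed as ℤD using (∣ᵤ⇒∣; ∣⇒∣ᵤ; ∣m∣n⇒∣m+n; ∣m⇒∣-m) renaming (_∣_ to _∣ₛ_)
open import Data.Integer.DivMod using (_%ℕ_; _/ℕ_; n%ℕd<d; a≡a%ℕn+[a/ℕn]*n)
open import Data.Integer.Tactic.RingSolver using (solve-∀)
open import Data.Fin using (Fin; zero; suc; toℕ; fromℕ<)
import Data.Fin.Properties as FinP
open import Data.Product using (_×_; _,_; ∃-syntax; proj₁; proj₂)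
open import Data.Sum using (_⊎_; inj₁; inj₂; reduce)
open import Data.List using (List; []; _∷_; _++_; _∷ʳ_; length; lookup; filter; tabulate; applyUpTo)
import Data.List.Properties as ListP
open import Data.List.Relation.Unary.Any as Any using (here; there)
open import Data.List.Relation.Unary.Any.Properties using (lookup-index)
import Data.List.Relation.Unary.All as All
open import Data.List.Relation.Unary.All using (All)
import Data.List.Relation.Unary.All.Properties as AllP
import Data.List.Relation.Unary.AllPairs as AllPairs
open import Data.List.Relation.Unary.Unique.Propositional using (Unique)
import Data.List.Relation.Unary.Unique.Propositional.Properties as UniqueP
open import Data.List.Membership.Propositional using (_∈_)
open import Data.List.Membership.Propositional.Properties
  using (∈-lookup; ∈-filter⁺; ∈-filter⁻; ∈-tabulate⁺; ∈-tabulate⁻)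
open import Data.List.Membership.Propositional.Properties.WithK using (unique∧set⇒bag)
open import Data.List.Relation.Binary.BagAndSetEquality using (∼bag⇒↭)
open import Data.List.Relation.Binary.Permutation.Propositional using (_↭_; ↭-refl; ↭-trans; ↭ₛ⇒↭)
open import Data.List.Relation.Binary.Permutation.Propositional.Properties using (↭-length; filter-↭; ++-comm; ++⁺ˡ)
import Data.List.Relation.Binary.Permutation.Setoid.Properties as SetoidPerm
open import Data.List.Relation.Binary.Pointwise using (Pointwise)
import Data.List.Relation.Binary.Pointwise as PW
open import Function.Bundles using (mk⇔)
open import Relation.Nullary using (¬_; Dec; yes; no; contradiction)
open import Relation.Nullary.Decidable using (_×-dec_)
open import Relation.Unary.Properties using (∁?)
open import Relation.Binary.PropositionalEquality as ≡
  using (_≡_; _≢_; refl; sym; trans; cong; cong₂; subst; subst₂; module ≡-Reasoning)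

-- x ∈ a(n) unfolds to the unsigned divisibility n ∣ |x - a|; the signed
-- divisibility relation has the closure lemmas we need.
∈⇒∣ : ∀ y (Q : AP) → y ∈AP Q → (+ modulus Q) ∣ₛ (y - residue Q)
∈⇒∣ y (a , n) = ∣ᵤ⇒∣ {+ n} {y - a}

∣⇒∈ : ∀ y (Q : AP) → (+ modulus Q) ∣ₛ (y - residue Q) → y ∈AP Q
∣⇒∈ y (a , n) = ∣⇒∣ᵤ {+ n} {y - a}

∣-modulus : ∀ {n n' d} → n ≡ n' → (+ n) ∣ₛ d → (+ n') ∣ₛ d
∣-modulus refl n∣d = n∣d

telescope : ∀ z y a → (z - y) + (y - a) ≡ z - a
telescope = solve-∀

∈-shift : ∀ {d} y z (Q : AP) → y ∈AP Q → (+ modulus Q) ∣ₛ d → z - y ≡ d → z ∈AP Q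
∈-shift y z Q y∈Q n∣d z-y≡d =
  ∣⇒∈ z Q (subst (_ ∣ₛ_) (telescope z y (residue Q)) (∣m∣n⇒∣m+n n∣z-y (∈⇒∣ y Q y∈Q)))
  where
  n∣z-y : (+ modulus Q) ∣ₛ (z - y)
  n∣z-y = subst (_ ∣ₛ_) (sym z-y≡d) n∣d

residue∈ : (Q : AP) → residue Q ∈AP Q
residue∈ (a , n) = subst (λ t → n ℕD.∣ ℤ.∣ t ∣) (sym (ℤP.+-inverseʳ a)) (n ℕD.∣0)

_∈?_ : (y : ℤ) (Q : AP) → Dec (y ∈AP Q)
y ∈? (a , n) = n ℕD.∣? ℤ.∣ y - a ∣

-- count y L is the number of members of L (with multiplicity) containing y;
-- exactness of a covering system says that every integer is counted once.
count : ℤ → List AP → ℕ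
count y L = length (filter (y ∈?_) L)

count-++ : ∀ y L M → count y (L ++ M) ≡ count y L ℕ.+ count y M
count-++ y L M = trans (cong length (ListP.filter-++ (y ∈?_) L M)) (ListP.length-++ (filter (y ∈?_) L))

count-↭ : ∀ y {L M} → L ↭ M → count y L ≡ count y M
count-↭ y L↭M = ↭-length (filter-↭ (y ∈?_) L↭M)

count-pos : ∀ y {L Q} → Q ∈ L → y ∈AP Q → 1 ≤ count y L
count-pos y Q∈L y∈Q = ListP.filter-some (y ∈?_) (Any.map (λ { refl → y∈Q }) Q∈L)

count-zero : ∀ y L → (∀ {Q} → Q ∈ L → ¬ y ∈AP Q) → count y L ≡ 0
count-zero y L y∉L = cong length (ListP.filter-none (y ∈?_) (All.tabulate y∉L))

count-∷ : ∀ y Q L → count y L ≤ count y (Q ∷ L)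
count-∷ y Q L = subst (count y L ≤_) (sym (count-++ y (Q ∷ []) L)) (ℕP.m≤n+m _ _)

at-most-one : ∀ {X : Set} {xs : List X} {u v} → length xs ≤ 1 → u ∈ xs → v ∈ xs → u ≡ v
at-most-one {xs = _ ∷ []} _ (here refl) (here refl) = refl
at-most-one {xs = _ ∷ []} _ (there ()) _
at-most-one {xs = _ ∷ []} _ _ (there ())
at-most-one {xs = _ ∷ _ ∷ _} (s≤s ()) _ _

count≤1⇒same : ∀ y {L Q R} → count y L ≤ 1 → Q ∈ L → R ∈ L → y ∈AP Q → y ∈AP R → Q ≡ R
count≤1⇒same y c Q∈L R∈L y∈Q y∈R =
  at-most-one c (∈-filter⁺ (y ∈?_) Q∈L y∈Q) (∈-filter⁺ (y ∈?_) R∈L y∈R)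

-- A list in which every integer is counted at most once has no repeated
-- progression: a repeated Q would count its own residue twice.
count≤1⇒Unique : ∀ L → (∀ y → count y L ≤ 1) → Unique L
count≤1⇒Unique [] _ = AllPairs.[]
count≤1⇒Unique (Q ∷ L) c = All.tabulate Q∉L AllPairs.∷ count≤1⇒Unique L (λ y → ℕP.≤-trans (count-∷ y Q L) (c y))
  where
  Q∉L : ∀ {R} → R ∈ L → Q ≢ R
  Q∉L R∈L refl = ℕP.<⇒≱ (s≤s (count-pos (residue Q) R∈L (residue∈ Q)))
    (subst (_≤ 1) (cong length (ListP.filter-accept (residue Q ∈?_) (residue∈ Q))) (c (residue Q)))

exact⇒count≡1 : ∀ y L (i : Fin (length L)) → y ∈AP lookup L i →
                ((j : Fin (length L)) → y ∈AP lookup L j → j ≡ i) → count y L ≡ 1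
exact⇒count≡1 y (Q ∷ L) zero y∈Q only = trans (cong length (ListP.filter-accept (y ∈?_) y∈Q)) (cong suc (count-zero y L y∉L))
  where
  y∉L : ∀ {R} → R ∈ L → ¬ y ∈AP R
  y∉L R∈L y∈R = FinP.0≢1+n (sym (only (suc (Any.index R∈L)) (subst (y ∈AP_) (lookup-index R∈L) y∈R)))
exact⇒count≡1 y (Q ∷ L) (suc i) y∈ only = trans (cong length (ListP.filter-reject (y ∈?_) y∉Q))
  (exact⇒count≡1 y L i y∈ (λ j y∈j → FinP.suc-injective (only (suc j) y∈j)))
  where
  y∉Q : ¬ y ∈AP Q
  y∉Q y∈Q = FinP.0≢1+n (only zero y∈Q)

count≡1⇒exact : ∀ y L → count y L ≡ 1 →
                ∃[ i ] (y ∈AP lookup L i × ((j : Fin (length L)) → y ∈AP lookup L j → j ≡ i))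
count≡1⇒exact y (Q ∷ L) c with y ∈? Q
... | yes y∈Q = zero , y∈Q , only-here
  where
  -- Q already accounts for the single count, so no later member contains y.
  only-here : (j : Fin (length (Q ∷ L))) → y ∈AP lookup (Q ∷ L) j → j ≡ zero
  only-here zero _ = refl
  only-here (suc j) y∈j = contradiction (ℕP.≤-reflexive c) (ℕP.<⇒≱ (s≤s (count-pos y (∈-lookup {xs = L} j) y∈j)))
... | no y∉Q with count≡1⇒exact y L c
...   | i , y∈i , only = suc i , y∈i , only-there
  where
  only-there : (j : Fin (length (Q ∷ L))) → y ∈AP lookup (Q ∷ L) j → j ≡ suc i
  only-there zero y∈Q = contradiction y∈Q y∉Q
  only-there (suc j) y∈j = cong suc (only j y∈j)

CoveredAt : List AP → ℕ → ℤ → Set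
CoveredAt A m y = ∃[ Q ] (Q ∈ A × y ∈AP Q × modulus Q ≡ m)

Admissible : List AP → ℕ → ℤ → ℤ → Set
Admissible A m T S = ∀ {Q} → Q ∈ A →
  (+ modulus Q) ∣ₛ T ⊎ (+ modulus Q) ∣ₛ S ⊎ modulus Q ≡ m

admissible-swap : ∀ {A m T S} → Admissible A m T S → Admissible A m S T
admissible-swap adm Q∈A with adm Q∈A
... | inj₁ n∣T = inj₂ (inj₁ n∣T)
... | inj₂ (inj₁ n∣S) = inj₁ n∣S
... | inj₂ (inj₂ n≡m) = inj₂ (inj₂ n≡m)

module ExactCover (A : List AP) (exact : ∀ y → count y A ≡ 1) where

  cover : ∀ y → ∃[ Q ] (Q ∈ A × y ∈AP Q)
  cover y with count≡1⇒exact y A (exact y)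
  ... | i , y∈ , _ = lookup A i , ∈-lookup i , y∈

  same : ∀ y {Q R} → Q ∈ A → R ∈ A → y ∈AP Q → y ∈AP R → Q ≡ R
  same y = count≤1⇒same y (ℕP.≤-reflexive (exact y))

  -- Whether y is covered at m is decided by the unique member containing y.
  covered? : ∀ m y → Dec (CoveredAt A m y)
  covered? m y with cover y
  ... | Q , Q∈A , y∈Q with modulus Q ℕ.≟ m
  ...   | yes n≡m = yes (Q , Q∈A , y∈Q , n≡m)
  ...   | no n≢m = no λ (R , R∈A , y∈R , n≡m) →
                   n≢m (subst (λ Z → modulus Z ≡ m) (same y R∈A Q∈A y∈R y∈Q) n≡m)

  covered-shift : ∀ {m d} y z → CoveredAt A m y → (+ m) ∣ₛ d → z - y ≡ d → CoveredAt A m z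
  covered-shift y z (Q , Q∈A , y∈Q , refl) m∣d e = Q , Q∈A , ∈-shift y z Q y∈Q m∣d e , refl

  -- Otherwise the members
  -- b ∋ x + T and c ∋ x + S would satisfy b ∣ S and c ∣ T (dividing the other
  -- shift would put x into them), so both contain x + T + S; hence b ≡ c
  -- contains x, which only the member of modulus m does.
  switch : ∀ {m T S} x → Admissible A m T S → CoveredAt A m x →
           CoveredAt A m (x + T) ⊎ CoveredAt A m (x + S)
  switch {m} {T} {S} x adm (a , a∈A , x∈a , a≡m) with cover (x + T) | cover (x + S)
  ... | b , b∈A , x+T∈b | c , c∈A , x+S∈c with modulus b ℕ.≟ m | modulus c ℕ.≟ m
  ...   | yes b≡m | _ = inj₁ (b , b∈A , x+T∈b , b≡m)
  ...   | no _ | yes c≡m = inj₂ (c , c∈A , x+S∈c , c≡m)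
  ...   | no b≢m | no c≢m = contradiction b∣S (not-back b∈A b≢m x+S∈b)
    where
    back : ∀ x U → x - (x + U) ≡ - U
    back = solve-∀
    drop-first : ∀ x U V → (x + U + V) - (x + U) ≡ V
    drop-first = solve-∀
    drop-second : ∀ x U V → (x + U + V) - (x + V) ≡ U
    drop-second = solve-∀
    not-back : ∀ {U Q} → Q ∈ A → modulus Q ≢ m → (x + U) ∈AP Q → ¬ (+ modulus Q) ∣ₛ U
    not-back {U} {Q} Q∈A Q≢m x+U∈Q n∣U = Q≢m (subst (λ Z → modulus Z ≡ m) a≡Q a≡m)
      where
      a≡Q : a ≡ Q
      a≡Q = same x a∈A Q∈A x∈a (∈-shift (x + U) x Q x+U∈Q (∣m⇒∣-m n∣U) (back x U))
    other : ∀ {U V Q} → Q ∈ A → modulus Q ≢ m → (x + U) ∈AP Q →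
            (+ modulus Q) ∣ₛ U ⊎ (+ modulus Q) ∣ₛ V ⊎ modulus Q ≡ m → (+ modulus Q) ∣ₛ V
    other Q∈A Q≢m x+U∈Q (inj₁ n∣U) = contradiction n∣U (not-back Q∈A Q≢m x+U∈Q)
    other Q∈A Q≢m x+U∈Q (inj₂ (inj₁ n∣V)) = n∣V
    other Q∈A Q≢m x+U∈Q (inj₂ (inj₂ n≡m)) = contradiction n≡m Q≢m
    b∣S : (+ modulus b) ∣ₛ S
    b∣S = other b∈A b≢m x+T∈b (adm b∈A)
    c∣T : (+ modulus c) ∣ₛ T
    c∣T = other c∈A c≢m x+S∈c (admissible-swap adm c∈A)
    c≡b : c ≡ b
    c≡b = same (x + T + S) c∈A b∈A
      (∈-shift (x + S) (x + T + S) c x+S∈c c∣T (drop-second x T S))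
      (∈-shift (x + T) (x + T + S) b x+T∈b b∣S (drop-first x T S))
    x+S∈b : (x + S) ∈AP b
    x+S∈b = subst ((x + S) ∈AP_) c≡b x+S∈c

below-divisor : ∀ {p d} → d < p → p ℕD.∣ d → d ≡ 0
below-divisor {d = zero} _ _ = refl
below-divisor {d = suc _} d<p p∣d = contradiction p∣d (ℕD.>⇒∤ d<p)

negate-difference : ∀ a b → - (a - b) ≡ b - a
negate-difference = solve-∀

congruent-ordered : ∀ {p a b} → a ≤ b → b < p → (+ p) ∣ₛ (+ b - + a) → b ≤ a
congruent-ordered {p} {a} {b} a≤b b<p p∣b-a =
  ℕP.m∸n≡0⇒m≤n (below-divisor (ℕP.≤-<-trans (ℕP.m∸n≤m b a) b<p) p∣b∸a)
  where
  p∣b∸a : p ℕD.∣ (b ℕ.∸ a)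
  p∣b∸a = subst (λ t → p ℕD.∣ ℤ.∣ t ∣) (trans (ℤP.m-n≡m⊖n b a) (ℤP.⊖-≥ a≤b)) (∣⇒∣ᵤ p∣b-a)

congruent-below : ∀ {p i j} → i < p → j < p → (+ p) ∣ₛ (+ j - + i) → i ≡ j
congruent-below {p} {i} {j} i<p j<p p∣j-i with ℕP.≤-total i j
... | inj₁ i≤j = ℕP.≤-antisym i≤j (congruent-ordered i≤j j<p p∣j-i)
... | inj₂ j≤i = sym (ℕP.≤-antisym j≤i (congruent-ordered j≤i i<p p∣i-j))
  where
  p∣i-j : (+ p) ∣ₛ (+ i - + j)
  p∣i-j = subst (_ ∣ₛ_) (negate-difference (+ j) (+ i)) (∣m⇒∣-m p∣j-i)

-- offset h j = j h: the starting points of the p progressions into which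
-- x(h) splits are x + offset h j for j < p.
offset : ℕ → {p : ℕ} → Fin p → ℤ
offset h j = + toℕ j ℤ.* + h

offset-representative : ∀ p h .{{_ : ℕ.NonZero p}} d → (+ h) ∣ₛ d → ∃[ j ] ((+ (p * h)) ∣ₛ (d - offset h {p} j))
offset-representative p h d (ℤD.divides c d≡c*h) = j , ℤD.divides (c /ℕ p) d-jh≡
  where
  j : Fin p
  j = fromℕ< (n%ℕd<d c p)
  cancel : ∀ r q P H → (r + q ℤ.* P) ℤ.* H - r ℤ.* H ≡ q ℤ.* (P ℤ.* H)
  cancel = solve-∀
  open ≡-Reasoning
  d-jh≡ : d - offset h j ≡ (c /ℕ p) ℤ.* + (p * h)
  d-jh≡ = begin
    d - offset h j
      ≡⟨ cong₂ (λ u v → u - + v ℤ.* + h) d≡c*h (FinP.toℕ-fromℕ< (n%ℕd<d c p)) ⟩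
    c ℤ.* + h - + (c %ℕ p) ℤ.* + h
      ≡⟨ cong (λ u → u ℤ.* + h - + (c %ℕ p) ℤ.* + h) (a≡a%ℕn+[a/ℕn]*n c p) ⟩
    (+ (c %ℕ p) + (c /ℕ p) ℤ.* + p) ℤ.* + h - + (c %ℕ p) ℤ.* + h
      ≡⟨ cancel (+ (c %ℕ p)) (c /ℕ p) (+ p) (+ h) ⟩
    (c /ℕ p) ℤ.* (+ p ℤ.* + h)
      ≡⟨ cong ((c /ℕ p) ℤ.*_) (sym (ℤP.pos-* p h)) ⟩
    (c /ℕ p) ℤ.* + (p * h) ∎

offset-injective : ∀ p h .{{_ : ℕ.NonZero h}} (i j : Fin p) →
                   (+ (p * h)) ∣ₛ (offset h j - offset h i) → i ≡ j
offset-injective p h i j ph∣ =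
  FinP.toℕ-injective (congruent-below (FinP.toℕ<n i) (FinP.toℕ<n j) (ℤD.*-cancelʳ-∣ (+ h) ph∣'))
  where
  factor : ∀ J I H → J ℤ.* H - I ℤ.* H ≡ (J - I) ℤ.* H
  factor = solve-∀
  ph∣' : (+ p ℤ.* + h) ∣ₛ ((+ toℕ j - + toℕ i) ℤ.* + h)
  ph∣' = subst₂ _∣ₛ_ (ℤP.pos-* p h) (factor (+ toℕ j) (+ toℕ i) (+ h)) ph∣

-- Tabulating f ∘ toℕ over Fin n lists f 0, …, f (n - 1); this reads
-- splitAP p (x , h) as a tabulation over Fin p.
tabulate-toℕ : ∀ {X : Set} (f : ℕ → X) n → tabulate (λ (j : Fin n) → f (toℕ j)) ≡ applyUpTo f n
tabulate-toℕ f zero = refl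
tabulate-toℕ f (suc n) = cong (f 0 ∷_) (tabulate-toℕ (λ k → f (suc k)) n)

-- Suppose m = p h with p prime and that each
-- x + j h (j < p) is covered by a member piece j of A of modulus m.  The
-- pieces are distinct and are exactly the members of modulus m whose residue
-- lies in x(h) (the "block"); replacing them by x(h) yields an exact
-- covering system B, and A primely splits B.
module Splitting
  (A : List AP) (positive : All (λ Q → 1 ≤ modulus Q) A) (exact : ∀ y → count y A ≡ 1)
  {p h m : ℕ} (p-prime : Prime p) (1≤h : 1 ≤ h) (m≡ph : m ≡ p * h)
  (x : ℤ) (tiled : (j : Fin p) → CoveredAt A m (x + offset h j))
  where

  open ExactCover A exact

  instance
    p≢0 : ℕ.NonZero p
    p≢0 = prime⇒nonZero p-prime
    h≢0 : ℕ.NonZero h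
    h≢0 = ℕ.>-nonZero 1≤h

  piece : Fin p → AP
  piece j = proj₁ (tiled j)

  piece∈A : ∀ j → piece j ∈ A
  piece∈A j = proj₁ (proj₂ (tiled j))

  start∈piece : ∀ j → (x + offset h j) ∈AP piece j
  start∈piece j = proj₁ (proj₂ (proj₂ (tiled j)))

  modulus-piece : ∀ j → modulus (piece j) ≡ m
  modulus-piece j = proj₂ (proj₂ (proj₂ (tiled j)))

  m∣start-residue : ∀ j → (+ m) ∣ₛ ((x + offset h j) - residue (piece j))
  m∣start-residue j =
    ∣-modulus (modulus-piece j) (∈⇒∣ (x + offset h j) (piece j) (start∈piece j))

  h∣m : (+ h) ∣ₛ (+ m)
  h∣m = ℤD.divides (+ p) (trans (cong +_ m≡ph) (ℤP.pos-* p h))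

  -- Distinct starting points x + i h, x + j h are incongruent modulo m, so
  -- they lie in distinct pieces.
  piece-injective : ∀ {i j} → piece i ≡ piece j → i ≡ j
  piece-injective {i} {j} piece-i≡piece-j =
    offset-injective p h i j (∣-modulus m≡ph m∣offsets)
    where
    cancel : ∀ x a I J → ((x + J) - a) - ((x + I) - a) ≡ J - I
    cancel = solve-∀
    m∣offsets : (+ m) ∣ₛ (offset h j - offset h i)
    m∣offsets = subst (_ ∣ₛ_) (cancel x (residue (piece i)) (offset h i) (offset h j))
      (ℤD.∣m∣n⇒∣m-n (subst (λ Q → (+ m) ∣ₛ ((x + offset h j) - residue Q)) (sym piece-i≡piece-j) (m∣start-residue j))
                    (m∣start-residue i))

  InBlock : AP → Set
  InBlock Q = modulus Q ≡ m × residue Q ∈AP (x , h)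

  inBlock? : ∀ Q → Dec (InBlock Q)
  inBlock? Q = (modulus Q ℕ.≟ m) ×-dec (residue Q ∈? (x , h))

  block rest : List AP
  block = filter inBlock? A
  rest = filter (∁? inBlock?) A

  block⊆start : ∀ {Q} y → Q ∈ block → y ∈AP Q → y ∈AP (x , h)
  block⊆start {Q} y Q∈block y∈Q = ∣⇒∈ y (x , h)
    (subst (_ ∣ₛ_) (telescope y (residue Q) x) (∣m∣n⇒∣m+n (ℤD.∣-trans h∣m m∣y-r) (∈⇒∣ (residue Q) (x , h) r∈start)))
    where
    Q-block = proj₂ (∈-filter⁻ inBlock? {xs = A} Q∈block)
    r∈start = proj₂ Q-block
    m∣y-r : (+ m) ∣ₛ (y - residue Q)
    m∣y-r = ∣-modulus (proj₁ Q-block) (∈⇒∣ y Q y∈Q)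

  start⊆pieces : ∀ y → y ∈AP (x , h) → ∃[ j ] (y ∈AP piece j)
  start⊆pieces y y∈start with offset-representative p h (y - x) (∈⇒∣ y (x , h) y∈start)
  ... | j , ph∣ = j , ∈-shift (x + offset h j) y (piece j) (start∈piece j)
                        (∣-modulus (sym (trans (modulus-piece j) m≡ph)) ph∣) (reassociate y x (offset h j))
    where
    reassociate : ∀ y x J → y - (x + J) ≡ (y - x) - J
    reassociate = solve-∀

  A-unique : Unique A
  A-unique = count≤1⇒Unique A (λ y → ℕP.≤-reflexive (exact y))

  block⊆pieces : ∀ {Q} → Q ∈ block → Q ∈ tabulate piece
  block⊆pieces {Q} Q∈block = subst (_∈ tabulate piece) (sym Q≡piece) (∈-tabulate⁺ j)
    where
    Q∈A : Q ∈ A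
    Q∈A = proj₁ (∈-filter⁻ inBlock? {xs = A} Q∈block)
    r∈start : residue Q ∈AP (x , h)
    r∈start = proj₂ (proj₂ (∈-filter⁻ inBlock? {xs = A} Q∈block))
    j : Fin p
    j = proj₁ (start⊆pieces (residue Q) r∈start)
    Q≡piece : Q ≡ piece j
    Q≡piece = same (residue Q) Q∈A (piece∈A j) (residue∈ Q) (proj₂ (start⊆pieces (residue Q) r∈start))

  pieces⊆block : ∀ {Q} → Q ∈ tabulate piece → Q ∈ block
  pieces⊆block Q∈pieces with ∈-tabulate⁻ Q∈pieces
  ... | j , refl = ∈-filter⁺ inBlock? (piece∈A j) (modulus-piece j , ∣⇒∈ (residue (piece j)) (x , h) h∣r-x)
    where
    unshift : ∀ r x J → J - ((x + J) - r) ≡ r - x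
    unshift = solve-∀
    h∣r-x : (+ h) ∣ₛ (residue (piece j) - x)
    h∣r-x = subst (_ ∣ₛ_) (unshift (residue (piece j)) x (offset h j))
      (ℤD.∣m∣n⇒∣m-n (ℤD.divides (+ toℕ j) refl) (ℤD.∣-trans h∣m (m∣start-residue j)))

  block↭pieces : block ↭ tabulate piece
  block↭pieces = ∼bag⇒↭ (unique∧set⇒bag (UniqueP.filter⁺ inBlock? A-unique) (UniqueP.tabulate⁺ piece-injective)
                                         (mk⇔ block⊆pieces pieces⊆block))

  A↭block++rest : A ↭ block ++ rest
  A↭block++rest = subst (λ (ys , zs) → A ↭ ys ++ zs) (ListP.partition-defn inBlock? A)
                        (↭ₛ⇒↭ (SetoidPerm.partition-↭ (≡.setoid AP) inBlock? A))

  A↭rest++pieces : A ↭ rest ++ tabulate piece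
  A↭rest++pieces = ↭-trans A↭block++rest (↭-trans (++-comm block rest) (++⁺ˡ rest block↭pieces))

  count-block+rest : ∀ y → count y block ℕ.+ count y rest ≡ 1
  count-block+rest y = trans (sym (count-++ y block rest)) (trans (sym (count-↭ y A↭block++rest)) (exact y))

  count-block : ∀ y → count y block ≡ count y ((x , h) ∷ [])
  count-block y = by-cases (y ∈? (x , h))
    where
    at-most : count y block ≤ 1
    at-most = ℕP.≤-trans (ℕP.m≤m+n _ _) (ℕP.≤-reflexive (count-block+rest y))
    by-cases : Dec (y ∈AP (x , h)) → count y block ≡ count y ((x , h) ∷ [])
    by-cases (yes y∈start) = trans (ℕP.≤-antisym at-most at-least)
                                   (sym (cong length (ListP.filter-accept (y ∈?_) y∈start)))
      where
      at-least : 1 ≤ count y block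
      at-least = count-pos y (pieces⊆block (∈-tabulate⁺ (proj₁ (start⊆pieces y y∈start))))
                             (proj₂ (start⊆pieces y y∈start))
    by-cases (no y∉start) = trans (count-zero y block (λ Q∈block y∈Q → y∉start (block⊆start y Q∈block y∈Q)))
                                  (sym (cong length (ListP.filter-reject (y ∈?_) y∉start)))

  B : List AP
  B = rest ∷ʳ (x , h)

  count-B : ∀ y → count y B ≡ 1
  count-B y = begin
    count y (rest ++ (x , h) ∷ [])                ≡⟨ count-++ y rest ((x , h) ∷ []) ⟩
    count y rest ℕ.+ count y ((x , h) ∷ [])       ≡⟨ cong (count y rest ℕ.+_) (sym (count-block y)) ⟩
    count y rest ℕ.+ count y block                ≡⟨ ℕP.+-comm (count y rest) (count y block) ⟩
    count y block ℕ.+ count y rest                ≡⟨ count-block+rest y ⟩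
    1 ∎
    where open ≡-Reasoning

  B-ecs : IsECS B
  B-ecs = AllP.++⁺ (AllP.filter⁺ (∁? inBlock?) positive) (1≤h All.∷ All.[]) ,
          λ y → count≡1⇒exact y B (count-B y)

  piece≈ : ∀ j → piece j ≈AP (x + offset h j , p * h)
  piece≈ j = trans (modulus-piece j) m≡ph ,
    ∣⇒∣ᵤ (subst ((+ modulus (piece j)) ∣ₛ_) (negate-difference (x + offset h j) (residue (piece j)))
               (∣m⇒∣-m (∈⇒∣ (x + offset h j) (piece j) (start∈piece j))))

  pieces≈split : Pointwise _≈AP_ (tabulate piece) (splitAP p (x , h))
  pieces≈split = subst (Pointwise _≈AP_ (tabulate piece)) (trans (tabulate-toℕ start p) (sym (ListP.map-upTo start p)))
                       (PW.tabulate⁺ piece≈)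
    where
    start : ℕ → AP
    start k = (x + + k ℤ.* + h , p * h)

  splits : ∃[ B ] (IsECS B × PrimelySplits A B)
  splits = B , B-ecs , p , p-prime , rest , (x , h) , ↭-refl , rest ++ tabulate piece ,
           A↭rest++pieces , PW.++⁺ (PW.refl (λ {Q} → refl , residue∈ Q)) pieces≈split

-- Moving from x by
-- multiples of τ instead of h only meets members of modulus ≥ p^(e+1).
record Direction (A : List AP) (p e h : ℕ) : Set where
  field
    τ : ℤ
    τ≡h : (+ (p * h)) ∣ₛ (τ - + h)
    classify : ∀ {Q} → Q ∈ A → (+ modulus Q) ∣ₛ τ ⊎ p ^ suc e ℕD.∣ modulus Q

module PrimeArithmetic {p : ℕ} (p-prime : Prime p) where

  1<p : 1 < p
  1<p = ℕ.nonTrivial⇒n>1 p {{prime⇒nonTrivial p-prime}}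

  p∤1 : ¬ p ℕD.∣ 1
  p∤1 p∣1 = ℕP.<⇒≱ 1<p (ℕD.∣⇒≤ p∣1)

  cofactor : ∀ {n} q → 1 ≤ n → n ≡ q * p → 1 ≤ q × q < n
  cofactor zero 1≤n n≡0 = contradiction (sym n≡0) (ℕP.<⇒≢ 1≤n)
  cofactor (suc q) _ n≡ = s≤s z≤n , subst (suc q <_) (sym n≡) (ℕP.m<m*n (suc q) p 1<p)

  p-part : ∀ n → 1 ≤ n → ∃[ c ] ∃[ n₀ ] (n ≡ p ^ c * n₀ × ¬ p ℕD.∣ n₀)
  p-part n 1≤n = go n 1≤n (<-wellFounded n)
    where
    go : ∀ n → 1 ≤ n → Acc _<_ n → ∃[ c ] ∃[ n₀ ] (n ≡ p ^ c * n₀ × ¬ p ℕD.∣ n₀)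
    go n 1≤n (acc smaller) with p ℕD.∣? n
    ... | no p∤n = 0 , n , sym (ℕP.*-identityˡ n) , p∤n
    ... | yes (ℕD.divides q n≡q*p) with cofactor q 1≤n n≡q*p
    ...   | 1≤q , q<n with go q 1≤q (smaller q<n)
    ...     | c , n₀ , q≡ , p∤n₀ = suc c , n₀ , n≡ , p∤n₀
      where
      open ≡-Reasoning
      n≡ : n ≡ p ^ suc c * n₀
      n≡ = begin
        n                 ≡⟨ n≡q*p ⟩
        q * p             ≡⟨ ℕP.*-comm q p ⟩
        p * q             ≡⟨ cong (p *_) q≡ ⟩
        p * (p ^ c * n₀)  ≡⟨ ℕP.*-assoc p (p ^ c) n₀ ⟨
        p ^ suc c * n₀    ∎

  ^-∣ : ∀ {c e} → c ≤ e → p ^ c ℕD.∣ p ^ e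
  ^-∣ {c} {e} c≤e = subst (p ^ c ℕD.∣_) pᶜpᵉ⁻ᶜ≡pᵉ (ℕD.m∣m*n (p ^ (e ℕ.∸ c)))
    where
    pᶜpᵉ⁻ᶜ≡pᵉ : p ^ c * p ^ (e ℕ.∸ c) ≡ p ^ e
    pᶜpᵉ⁻ᶜ≡pᵉ = trans (sym (ℕP.^-distribˡ-+-* p c (e ℕ.∸ c))) (cong (p ^_) (ℕP.m+[n∸m]≡n c≤e))

  -- Writing each modulus as p^c n₀, the parts n₀ all divide one U prime to p;
  -- thus every modulus n satisfies p^c ∣ n and n ∣ p^c U for some c.
  p-free-bound : ∀ L → All (λ Q → 1 ≤ modulus Q) L →
    ∃[ U ] (¬ p ℕD.∣ U × (∀ {Q} → Q ∈ L → ∃[ c ] (p ^ c ℕD.∣ modulus Q × modulus Q ℕD.∣ p ^ c * U)))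
  p-free-bound [] All.[] = 1 , p∤1 , λ { () }
  p-free-bound (Q ∷ L) (1≤n All.∷ positive) with p-part (modulus Q) 1≤n | p-free-bound L positive
  ... | c , n₀ , n≡ , p∤n₀ | U , p∤U , bound = n₀ * U , p∤n₀U , bound′
    where
    p∤n₀U : ¬ p ℕD.∣ n₀ * U
    p∤n₀U p∣n₀U with euclidsLemma n₀ U p-prime p∣n₀U
    ... | inj₁ p∣n₀ = p∤n₀ p∣n₀
    ... | inj₂ p∣U = p∤U p∣U
    bound′ : ∀ {R} → R ∈ Q ∷ L → ∃[ c ] (p ^ c ℕD.∣ modulus R × modulus R ℕD.∣ p ^ c * (n₀ * U))
    bound′ (here refl) = c , subst (p ^ c ℕD.∣_) (sym n≡) (ℕD.m∣m*n n₀) ,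
                         subst (ℕD._∣ p ^ c * (n₀ * U)) (sym n≡) (ℕD.*-monoʳ-∣ (p ^ c) (ℕD.m∣m*n U))
    bound′ (there R∈L) with bound R∈L
    ... | c′ , pᶜ∣n , n∣pᶜU = c′ , pᶜ∣n , ℕD.∣-trans n∣pᶜU (ℕD.*-monoʳ-∣ (p ^ c′) (ℕD.n∣m*n n₀))

  ∤⇒coprime : ∀ {U} → ¬ p ℕD.∣ U → Coprime U p
  ∤⇒coprime p∤U (d∣U , d∣p) with prime⇒irreducible p-prime d∣p
  ... | inj₁ d≡1 = d≡1
  ... | inj₂ refl = contradiction d∣U p∤U

  lift : ∀ a b c d → 1 ℕ.+ a * b ≡ c * d → + 1 + + a ℤ.* + b ≡ + c ℤ.* + d
  lift a b c d e =
    trans (cong (ℤ._+_ (+ 1)) (sym (ℤP.pos-* a b))) (trans (sym (ℤP.pos-+ 1 (a * b))) (trans (cong +_ e) (ℤP.pos-* c d)))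

  inverse : ∀ {U} → ¬ p ℕD.∣ U → ∃[ v ] ∃[ W ] (+ U ℤ.* v ≡ + 1 + + p ℤ.* W)
  inverse {U} p∤U with coprime-Bézout (∤⇒coprime p∤U)
  ... | Bézout.+- a b 1+bp≡aU = + a , + b ,
        trans (ℤP.*-comm (+ U) (+ a)) (trans (sym (lift b p a U 1+bp≡aU)) (cong (ℤ._+_ (+ 1)) (ℤP.*-comm (+ b) (+ p))))
  ... | Bézout.-+ a b 1+aU≡bp = - + a , - + b ,
        trans (rearrange (+ U) (+ a) (+ b) (+ p))
          (trans (cong (λ t → (+ 1 + + p ℤ.* - + b) + (+ b ℤ.* + p - t)) (lift a U b p 1+aU≡bp))
            (trans (cong (ℤ._+_ (+ 1 + + p ℤ.* - + b)) (ℤP.+-inverseʳ (+ b ℤ.* + p))) (ℤP.+-identityʳ _)))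
    where
    rearrange : ∀ U a b p → U ℤ.* - a ≡ (+ 1 + p ℤ.* - b) + (b ℤ.* p - (+ 1 + a ℤ.* U))
    rearrange = solve-∀

  -- If p^e ∣ h, τ = h U v is a direction (U as in p-free-bound, v its inverse).
  direction : ∀ A → All (λ Q → 1 ≤ modulus Q) A → ∀ e h → p ^ e ℕD.∣ h → Direction A p e h
  direction A positive e h pᵉ∣h with p-free-bound A positive
  ... | U , p∤U , bound with inverse p∤U
  ...   | v , W , Uv≡ = record { τ = τ ; τ≡h = ℤD.divides W τ-h≡ ; classify = classify }
    where
    τ : ℤ
    τ = + (h * U) ℤ.* v
    expand : ∀ H P W → H ℤ.* (+ 1 + P ℤ.* W) - H ≡ W ℤ.* (P ℤ.* H)
    expand = solve-∀
    open ≡-Reasoning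
    τ-h≡ : τ - + h ≡ W ℤ.* + (p * h)
    τ-h≡ = begin
      + (h * U) ℤ.* v - + h              ≡⟨ cong (λ t → t ℤ.* v - + h) (ℤP.pos-* h U) ⟩
      (+ h ℤ.* + U) ℤ.* v - + h          ≡⟨ cong (_- + h) (ℤP.*-assoc (+ h) (+ U) v) ⟩
      + h ℤ.* (+ U ℤ.* v) - + h          ≡⟨ cong (λ t → + h ℤ.* t - + h) Uv≡ ⟩
      + h ℤ.* (+ 1 + + p ℤ.* W) - + h    ≡⟨ expand (+ h) (+ p) W ⟩
      W ℤ.* (+ p ℤ.* + h)                ≡⟨ cong (W ℤ.*_) (ℤP.pos-* p h) ⟨
      W ℤ.* + (p * h)                    ∎
    classify : ∀ {Q} → Q ∈ A → (+ modulus Q) ∣ₛ τ ⊎ p ^ suc e ℕD.∣ modulus Q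
    classify Q∈A with bound Q∈A
    ... | c , pᶜ∣n , n∣pᶜU with c ℕ.≤? e
    ...   | yes c≤e = inj₁ (ℤD.∣m⇒∣m*n {m = + (h * U)} v (∣ᵤ⇒∣ (ℕD.∣-trans n∣pᶜU (ℕD.*-monoˡ-∣ U (ℕD.∣-trans (^-∣ c≤e) pᵉ∣h)))))
    ...   | no c≰e = inj₂ (ℕD.∣-trans (^-∣ (ℕP.≰⇒> c≰e)) pᶜ∣n)

prime∣prime^⇒≡ : ∀ {p q} b → Prime p → Prime q → p ℕD.∣ q ^ b → p ≡ q
prime∣prime^⇒≡ zero p-prime _ p∣1 = contradiction p∣1 (PrimeArithmetic.p∤1 p-prime)
prime∣prime^⇒≡ {p} {q} (suc b) p-prime q-prime p∣qᵇ⁺¹ with euclidsLemma q (q ^ b) p-prime p∣qᵇ⁺¹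
... | inj₂ p∣qᵇ = prime∣prime^⇒≡ b p-prime q-prime p∣qᵇ
... | inj₁ p∣q with prime⇒irreducible q-prime p∣q
...   | inj₁ refl = contradiction ℕD.∣-refl (PrimeArithmetic.p∤1 p-prime)
...   | inj₂ p≡q = p≡q

prime-powers-∣ : ∀ {p q} a b {n} → Prime p → Prime q → p ≢ q →
                 p ^ a ℕD.∣ n → q ^ b ℕD.∣ n → p ^ a * q ^ b ℕD.∣ n
prime-powers-∣ {p} {q} a b p-prime q-prime p≢q (ℕD.divides k n≡kpᵃ) qᵇ∣n =
  subst (p ^ a * q ^ b ℕD.∣_) (sym n≡pᵃk) (ℕD.*-monoʳ-∣ (p ^ a) (strip a (subst (q ^ b ℕD.∣_) n≡pᵃk qᵇ∣n)))
  where
  n≡pᵃk = trans n≡kpᵃ (ℕP.*-comm k (p ^ a))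
  qᵇ⊥p : Coprime (q ^ b) p
  qᵇ⊥p (d∣qᵇ , d∣p) with prime⇒irreducible p-prime d∣p
  ... | inj₁ d≡1 = d≡1
  ... | inj₂ refl = contradiction (prime∣prime^⇒≡ b p-prime q-prime d∣qᵇ) p≢q
  strip : ∀ c {k} → q ^ b ℕD.∣ p ^ c * k → q ^ b ℕD.∣ k
  strip zero {k} qᵇ∣ = subst (q ^ b ℕD.∣_) (ℕP.*-identityˡ k) qᵇ∣
  strip (suc c) {k} qᵇ∣ = strip c (coprime-divisor qᵇ⊥p (subst (q ^ b ℕD.∣_) (ℕP.*-assoc p (p ^ c) k) qᵇ∣))

data Shape (m : ℕ) : Set where
  unit : m ≡ 1 → Shape m
  prime-power : ∀ {p} e → Prime p → m ≡ p ^ suc e → Shape m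
  two-primes : ∀ {p q} e f → Prime p → Prime q → p ≢ q → m ≡ p ^ suc e * q ^ suc f → Shape m

shape : ∀ {p₁ p₂} k₁ k₂ → Prime p₁ → Prime p₂ → Shape (p₁ ^ k₁ * p₂ ^ k₂)
shape zero zero _ _ = unit refl
shape zero (suc b) _ p₂-prime = prime-power b p₂-prime (ℕP.*-identityˡ _)
shape (suc a) zero p₁-prime _ = prime-power a p₁-prime (ℕP.*-identityʳ _)
shape {p₁} {p₂} (suc a) (suc b) p₁-prime p₂-prime with p₁ ℕ.≟ p₂
... | yes refl = prime-power (a ℕ.+ suc b) p₁-prime (sym (ℕP.^-distribˡ-+-* p₁ (suc a) (suc b)))
... | no p₁≢p₂ = two-primes a b p₁-prime p₂-prime p₁≢p₂ refl

unit-∈ : ∀ y (Q : AP) → modulus Q ≡ 1 → y ∈AP Q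
unit-∈ y (a , n) refl = ℕD.1∣ _

unit-moduli⇒trivial : ∀ L → (∀ {Q} → Q ∈ L → modulus Q ≡ 1) → count (+ 0) L ≡ 1 → IsTrivial L
unit-moduli⇒trivial [] _ ()
unit-moduli⇒trivial ((a , n) ∷ []) all-unit _ = (all-unit (here refl) , unit-∈ a (+ 0 , n) (all-unit (here refl))) PW.∷ PW.[]
unit-moduli⇒trivial (Q ∷ R ∷ L) all-unit once = contradiction (sym once) (ℕP.<⇒≢ 2≤count)
  where
  2≤count : 2 ≤ count (+ 0) (Q ∷ R ∷ L)
  2≤count = subst (2 ≤_) (sym (cong length (ListP.filter-accept (_∈?_ (+ 0)) (unit-∈ (+ 0) Q (all-unit (here refl))))))
                  (s≤s (count-pos (+ 0) (here refl) (unit-∈ (+ 0) R (all-unit (there (here refl))))))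

maximal-modulus : ∀ {A m} → IsMaximalModulus A m → ∀ {Q} → Q ∈ A → m ℕD.∣ modulus Q → modulus Q ≡ m
maximal-modulus {A} {m} (_ , _ , maximal) {Q} Q∈A m∣n =
  sym (trans (maximal (Any.index Q∈A) (subst (λ R → m ℕD.∣ modulus R) Q≡ m∣n)) (cong modulus (sym Q≡)))
  where
  Q≡ : Q ≡ lookup A (Any.index Q∈A)
  Q≡ = lookup-index Q∈A

module MaximalModulus
  (A : List AP) (positive : All (λ Q → 1 ≤ modulus Q) A) (exact : ∀ y → count y A ≡ 1)
  {m : ℕ} (maximal : ∀ {Q} → Q ∈ A → m ℕD.∣ modulus Q → modulus Q ≡ m) (1≤m : 1 ≤ m)
  (x : ℤ) (x-covered : CoveredAt A m x)
  where

  open ExactCover A exact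
  open Direction

  Splits : Set
  Splits = ∃[ B ] (IsECS B × PrimelySplits A B)

  unit-case : m ≡ 1 → IsTrivial A
  unit-case m≡1 = unit-moduli⇒trivial A (λ Q∈A → trans (maximal Q∈A (subst (ℕD._∣ _) (sym m≡1) (ℕD.1∣ _))) m≡1)
                                      (exact (+ 0))

  positive-cofactor : ∀ p h → m ≡ p * h → 1 ≤ h
  positive-cofactor p zero m≡0 = contradiction (sym (trans m≡0 (ℕP.*-zeroʳ p))) (ℕP.<⇒≢ 1≤m)
  positive-cofactor p (suc h) _ = s≤s z≤n

  toward : ∀ {p e h} (D : Direction A p e h) → m ≡ p * h → ∀ J →
           CoveredAt A m (x + J ℤ.* τ D) → CoveredAt A m (x + J ℤ.* + h)
  toward {h = h} D m≡ J covered = covered-shift (x + J ℤ.* τ D) (x + J ℤ.* + h) covered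
    (∣m⇒∣-m (ℤD.∣n⇒∣m*n J (∣-modulus (sym m≡) (τ≡h D)))) (difference x J (+ h) (τ D))
    where
    difference : ∀ x J H T → (x + J ℤ.* H) - (x + J ℤ.* T) ≡ - (J ℤ.* (T - H))
    difference = solve-∀

  -- m = p^(e+1): every modulus not dividing τ is a multiple of m, hence m,
  -- so switching with T = S = j τ shows that every x + j p^e is covered.
  prime-power-case : ∀ {p} e → Prime p → m ≡ p ^ suc e → Splits
  prime-power-case {p} e p-prime m≡ =
    Splitting.splits A positive exact p-prime (positive-cofactor p (p ^ e) m≡) m≡ x tiled
    where
    D : Direction A p e (p ^ e)
    D = PrimeArithmetic.direction p-prime A positive e (p ^ e) ℕD.∣-refl
    admissible : ∀ J → Admissible A m (J ℤ.* τ D) (J ℤ.* τ D)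
    admissible J Q∈A with classify D Q∈A
    ... | inj₁ n∣τ = inj₁ (ℤD.∣n⇒∣m*n J n∣τ)
    ... | inj₂ pᵉ⁺¹∣n = inj₂ (inj₂ (maximal Q∈A (subst (ℕD._∣ _) (sym m≡) pᵉ⁺¹∣n)))
    tiled : ∀ j → CoveredAt A m (x + offset (p ^ e) j)
    tiled j = toward D m≡ (+ toℕ j) (reduce (switch x (admissible (+ toℕ j)) x-covered))

  -- m = p^(e+1) q^(f+1) with p ≢ q: either every x + i h_p is covered
  -- (split along p), or some x + i h_p is not, and then switching between
  -- i τ_p and j τ_q shows that every x + j h_q is covered (split along q).
  module TwoPrimes {p q} (e f : ℕ) (p-prime : Prime p) (q-prime : Prime q) (p≢q : p ≢ q)
                   (m≡ : m ≡ p ^ suc e * q ^ suc f) where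

    hp hq : ℕ
    hp = p ^ e * q ^ suc f
    hq = q ^ f * p ^ suc e

    m≡php : m ≡ p * hp
    m≡php = trans m≡ (ℕP.*-assoc p (p ^ e) (q ^ suc f))

    m≡qhq : m ≡ q * hq
    m≡qhq = trans m≡ (trans (ℕP.*-comm (p ^ suc e) (q ^ suc f)) (ℕP.*-assoc q (q ^ f) (p ^ suc e)))

    Dp : Direction A p e hp
    Dp = PrimeArithmetic.direction p-prime A positive e hp (ℕD.m∣m*n _)

    Dq : Direction A q f hq
    Dq = PrimeArithmetic.direction q-prime A positive f hq (ℕD.m∣m*n _)

    -- A modulus dividing neither I τ_p nor J τ_q is a multiple of both prime
    -- powers, hence of m, hence equal to m.
    admissible : ∀ I J → Admissible A m (I ℤ.* τ Dp) (J ℤ.* τ Dq)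
    admissible I J Q∈A with classify Dp Q∈A | classify Dq Q∈A
    ... | inj₁ n∣τp | _ = inj₁ (ℤD.∣n⇒∣m*n I n∣τp)
    ... | inj₂ _ | inj₁ n∣τq = inj₂ (inj₁ (ℤD.∣n⇒∣m*n J n∣τq))
    ... | inj₂ pᵉ⁺¹∣n | inj₂ qᶠ⁺¹∣n = inj₂ (inj₂ (maximal Q∈A (subst (ℕD._∣ _) (sym m≡)
            (prime-powers-∣ (suc e) (suc f) p-prime q-prime p≢q pᵉ⁺¹∣n qᶠ⁺¹∣n))))

    q-tiled : ∀ (i : Fin p) → ¬ CoveredAt A m (x + offset hp i) → ∀ j → CoveredAt A m (x + offset hq {q} j)
    q-tiled i gap j with switch x (admissible (+ toℕ i) (+ toℕ j)) x-covered
    ... | inj₁ covered-p = contradiction (toward Dp m≡php (+ toℕ i) covered-p) gap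
    ... | inj₂ covered-q = toward Dq m≡qhq (+ toℕ j) covered-q

    splits : Splits
    splits with FinP.all? (λ i → covered? m (x + offset hp {p} i))
    ... | yes p-tiled = Splitting.splits A positive exact p-prime (positive-cofactor p hp m≡php) m≡php x p-tiled
    ... | no ¬p-tiled with FinP.¬∀⟶∃¬ p _ (λ i → covered? m (x + offset hp i)) ¬p-tiled
    ...   | i , gap = Splitting.splits A positive exact q-prime (positive-cofactor q hq m≡qhq) m≡qhq x (q-tiled i gap)

theoremA : (A : List AP) → IsECS A → ¬ IsTrivial A →
    (p₁ p₂ k₁ k₂ : ℕ) → Prime p₁ → Prime p₂ →
    IsMaximalModulus A (p₁ ^ k₁ * p₂ ^ k₂) →
    ∃[ B ] (IsECS B × PrimelySplits A B)
theoremA A (positive , exact-at) nontrivial p₁ p₂ k₁ k₂ p₁-prime p₂-prime m-maximal =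
  by-shape (shape k₁ k₂ p₁-prime p₂-prime)
  where
  r = proj₁ m-maximal
  R = lookup A r
  modulus-R = proj₁ (proj₂ m-maximal)
  exact : ∀ y → count y A ≡ 1
  exact y = exact⇒count≡1 y A (proj₁ (exact-at y)) (proj₁ (proj₂ (exact-at y))) (proj₂ (proj₂ (exact-at y)))
  open MaximalModulus A positive exact (maximal-modulus m-maximal)
         (subst (1 ≤_) modulus-R (All.lookup positive (∈-lookup r)))
         (residue R) (R , ∈-lookup r , residue∈ R , modulus-R)
  by-shape : Shape (p₁ ^ k₁ * p₂ ^ k₂) → Splits
  by-shape (unit m≡1) = contradiction (unit-case m≡1) nontrivial
  by-shape (prime-power e p-prime m≡) = prime-power-case e p-prime m≡
  by-shape (two-primes e f p-prime q-prime p≢q m≡) = TwoPrimes.splits e f p-prime q-prime p≢q m≡
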